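{- Fix a nested system of fundamental sequences on an ordinal $\Gamma$. For every ordinal $\alpha\le\Gamma$ and every natural number $n\ge|\alpha|$, we have $\Gamma\Rightarrow_n\alpha$.
   Context: A fundamental sequence for $\alpha>0$ is a non-decreasing sequence $(\alpha[n])_{n\in\omega}$ with $\sup_n(\alpha[n]+1)=\alpha$; $0[n]=0$. A system on $\Gamma$ fixes one for each $\alpha\le\Gamma$; it is nested if there are never $\gamma<\beta\le\Gamma$ and $n>1$ with $\gamma>\beta[n]>\gamma[n]$. $\alpha\Rightarrow_n\beta$ means $\beta=\alpha[n][n]\cdots[n]$ for some finite number (possibly $0$) of applications of $[n]$. The norm $|\alpha|$ of $\alpha\le\Gamma$ is $\min\{n>1:\Gamma\Rightarrow_n\alpha\}$ (this exists for nested systems). -}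

module Defs where

open import Level using (0ℓ)
open import Data.Nat using (ℕ; zero; suc) renaming (_<_ to _<ℕ_; _≤_ to _≤ℕ_)
open import Data.Product using (Σ; ∃; _×_; _,_)
open import Data.Sum using (_⊎_)
open import Relation.Nullary using (¬_)
open import Relation.Binary.PropositionalEquality using (_≡_; _≢_)
open import Relation.Binary.Structures using (IsStrictTotalOrder)
open import Induction.WellFounded using (WellFounded)

-- The ordinals ≤ Γ, presented as a well-ordered set (every well-ordered set is
-- order-isomorphic to a unique ordinal): a strict total well-order with a
-- least element 𝟘 (the ordinal 0) and a greatest element Γ.
record OrdinalsUpTo : Set₁ where
  field
    Ord  : Set
    _<_  : Ord → Ord → Set
    isSTO : IsStrictTotalOrder _≡_ _<_
    wf   : WellFounded _<_
    𝟘    : Ord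
    𝟘-least : ∀ α → ¬ (α < 𝟘)
    Γ    : Ord
    Γ-greatest : ∀ α → ¬ (Γ < α)

  _≤_ : Ord → Ord → Set
  α ≤ β = (α < β) ⊎ (α ≡ β)

iter : {A : Set} → (A → A) → ℕ → A → A
iter f zero    a = a
iter f (suc k) a = f (iter f k a)

-- A system of fundamental sequences on Γ.
-- sup_n (α[n]+1) = α (for α > 0) is expressed as: every α[n] < α, and
-- every β < α is ≤ some α[n].
record FundamentalSystem (O : OrdinalsUpTo) : Set where
  open OrdinalsUpTo O
  field
    _[_]      : Ord → ℕ → Ord
    zero-seq  : ∀ n → 𝟘 [ n ] ≡ 𝟘
    nondecr   : ∀ α n → (α [ n ]) ≤ (α [ suc n ])
    below     : ∀ α n → α ≢ 𝟘 → (α [ n ]) < α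
    cofinal   : ∀ α β → β < α → ∃ λ n → β ≤ (α [ n ])

  Nested : Set
  Nested = ∀ γ β n → γ < β → 1 <ℕ n → ¬ (((β [ n ]) < γ) × ((γ [ n ]) < (β [ n ])))

  _⇒[_]_ : Ord → ℕ → Ord → Set
  α ⇒[ n ] β = ∃ λ k → iter (λ x → x [ n ]) k α ≡ β

  IsNorm : Ord → ℕ → Set
  IsNorm α k = (1 <ℕ k) × (Γ ⇒[ k ] α) × (∀ j → 1 <ℕ j → Γ ⇒[ j ] α → k ≤ℕ j)

{-# OPTIONS --safe #-}
module Submission where

-- Let 1 < k ≤ n. Descending from β along [n] never jumps over β[k]: if
-- β[k] < γ ≤ β then β[k] ≤ γ[n], since for γ = β this is monotonicity of the
-- fundamental sequence, and for γ < β nestedness forbids γ[k] < β[k] < γ and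
-- γ[k] ≤ γ[n]. By well-founded descent β ⇒ₙ β[k], so every step of Γ ⇒ₖ α can be
-- replaced by finitely many [n]-steps.

open import Defs
open import Data.Nat using (ℕ; zero; suc; _+_; _≤′_; ≤′-refl; ≤′-step)
  renaming (_≤_ to _≤ℕ_; _<_ to _<ℕ_)
open import Data.Nat.Properties using (≤⇒≤′)
open import Data.Product using (_,_)
open import Data.Sum using (inj₁; inj₂)
open import Relation.Nullary using (yes; no; contradiction)
open import Relation.Binary.PropositionalEquality using (_≡_; _≢_; refl; cong)
open import Relation.Binary.Definitions using (tri<; tri≈; tri>)
open import Relation.Binary.Structures using (IsStrictTotalOrder; IsTotalOrder)
import Relation.Binary.Construct.StrictToNonStrict as NonStrict
open import Induction.WellFounded using (Acc; acc)

iter-+ : {A : Set} (f : A → A) (j i : ℕ) (x : A) → iter f (j + i) x ≡ iter f j (iter f i x)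
iter-+ f zero    i x = refl
iter-+ f (suc j) i x = cong f (iter-+ f j i x)

module _ {O : OrdinalsUpTo} (S : FundamentalSystem O) where
  open OrdinalsUpTo O
  open FundamentalSystem S
  open IsStrictTotalOrder isSTO using (compare; _≟_; <-respʳ-≈) renaming (trans to <-trans)
  open IsTotalOrder (NonStrict.isTotalOrder _≡_ _<_ isSTO) using () renaming (trans to ≤-trans)

  <-≤-trans : ∀ {α β γ} → α < β → β ≤ γ → α < γ
  <-≤-trans = NonStrict.<-≤-trans _≡_ _<_ <-trans <-respʳ-≈

  >⇒≢𝟘 : ∀ {α β} → β < α → α ≢ 𝟘
  >⇒≢𝟘 β<α refl = 𝟘-least _ β<α

  []-≤ : ∀ α n → (α [ n ]) ≤ α
  []-≤ α n with α ≟ 𝟘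
  ... | yes refl = inj₂ (zero-seq n)
  ... | no  α≢𝟘  = inj₁ (below α n α≢𝟘)

  []-mono : ∀ α {m n} → m ≤′ n → (α [ m ]) ≤ (α [ n ])
  []-mono α ≤′-refl          = inj₂ refl
  []-mono α (≤′-step {n} m≤n) = ≤-trans ([]-mono α m≤n) (nondecr α n)

  ⇒-refl : ∀ {α n} → α ⇒[ n ] α
  ⇒-refl = 0 , refl

  ⇒-trans : ∀ {α β γ n} → α ⇒[ n ] β → β ⇒[ n ] γ → α ⇒[ n ] γ
  ⇒-trans {α} {n = n} (i , refl) (j , refl) = j + i , iter-+ (_[ n ]) j i α

  ⇒-step : ∀ {α n} → α ⇒[ n ] (α [ n ])
  ⇒-step = 1 , refl

  module _ (nested : Nested) {k n : ℕ} (1<k : 1 <ℕ k) (k≤n : k ≤ℕ n) where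

    [k]-≤-[n] : ∀ {β γ} → γ ≤ β → (β [ k ]) < γ → (β [ k ]) ≤ (γ [ n ])
    [k]-≤-[n] {γ = γ} (inj₂ refl) _ = []-mono γ (≤⇒≤′ k≤n)
    [k]-≤-[n] {β} {γ} (inj₁ γ<β) β[k]<γ = ≤-trans β[k]≤γ[k] ([]-mono γ (≤⇒≤′ k≤n))
      where
      β[k]≤γ[k] : (β [ k ]) ≤ (γ [ k ])
      β[k]≤γ[k] with compare (β [ k ]) (γ [ k ])
      ... | tri< lt _ _ = inj₁ lt
      ... | tri≈ _ eq _ = inj₂ eq
      ... | tri> _ _ gt = contradiction (β[k]<γ , gt) (nested γ β k γ<β 1<k)

    ⇒-[k]-between : ∀ {β γ} → Acc _<_ γ → (β [ k ]) ≤ γ → γ ≤ β → γ ⇒[ n ] (β [ k ])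
    ⇒-[k]-between _ (inj₂ refl) _ = ⇒-refl
    ⇒-[k]-between {β} {γ} (acc rs) (inj₁ β[k]<γ) γ≤β =
      ⇒-trans ⇒-step
        (⇒-[k]-between (rs γ[n]<γ) ([k]-≤-[n] γ≤β β[k]<γ) (inj₁ (<-≤-trans γ[n]<γ γ≤β)))
      where
      γ[n]<γ : (γ [ n ]) < γ
      γ[n]<γ = below γ n (>⇒≢𝟘 β[k]<γ)

    ⇒-[k] : ∀ β → β ⇒[ n ] (β [ k ])
    ⇒-[k] β = ⇒-[k]-between (wf β) ([]-≤ β k) (inj₂ refl)

    ⇒-index-mono : ∀ {α β} → α ⇒[ k ] β → α ⇒[ n ] β
    ⇒-index-mono (zero  , refl) = ⇒-refl
    ⇒-index-mono (suc j , refl) = ⇒-trans (⇒-index-mono (j , refl)) (⇒-[k] _)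

proposition2p11 : (O : OrdinalsUpTo) → (S : FundamentalSystem O) →
    FundamentalSystem.Nested S →
    ∀ α k n → FundamentalSystem.IsNorm S α k → k ≤ℕ n →
    FundamentalSystem._⇒[_]_ S (OrdinalsUpTo.Γ O) n α
proposition2p11 O S nested α k n (1<k , Γ⇒ₖα , _) k≤n = ⇒-index-mono S nested 1<k k≤n Γ⇒ₖα
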